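{- Let $v,d\ge0$. Every characteristic minmatrix in $\mathbf{K}[\![v,d]\!]$ is a union of complete prime orbits of $\mathbf{K}[v,d]$; that is, if $\xi\in\mathbf{K}[\![v,d]\!]$ and $\omega$ is a prime orbit with $\xi\cap\omega\ne\emptyset$, then $\omega\subseteq\xi$.
   Context: Formulas are unimodal propositional formulas in variables $p_0,\dots,p_{v-1}$; $\mathbf{K}$ is the least normal modal logic; a normal modal logic is a normal extension of $\mathbf{K}$. $\mathbf{K}[v,d]$ is the Lindenbaum–Tarski algebra of formulas in $p_0,\dots,p_{v-1}$ of modal degree $\le d$ modulo $\mathbf{K}$-equivalence; it is a finite Boolean algebra whose atoms (minterms) are: level 0: the $2^v$ conjunctions $\bigwedge_i\pm p_i$; level $d+1$: all $m\wedge\bigwedge_\mu\pm\Diamond\mu$ with $m$ a level-0 minterm and $\mu$ ranging over all level-$d$ minterms. Each element $\varphi$ is identified with its set $[\varphi]$ of minterms. For a normal modal logic $\mathbf{S}$, its characteristic minmatrix is $[\![\mathbf{S}]\!]=\bigcap\{[\varphi]:\varphi\in\mathbf{K}[v,d],\ \mathbf{S}\vdash\varphi\}$, and $\mathbf{K}[\![v,d]\!]$ is the set of all such CMMs. A level-0 substitution is a tuple $(\sigma_0,\dots,\sigma_{v-1})$ of classical propositional formulas in $p_0,\dots,p_{v-1}$ acting by $\varphi\circ\sigma=\varphi(\sigma_0,\dots,\sigma_{v-1})$; under composition $(\sigma\sigma')_i=\sigma_i(\sigma'_0,\dots,\sigma'_{v-1})$ they form a monoid, whose invertible elements (prime substitutions)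 form a group $\mathcal{S}_p(v,0)$ acting on the level-$d$ minterms by $\mu\mapsto\mu\circ\varsigma$. The orbits of this action are the prime orbits of $\mathbf{K}[v,d]$. -}

module Defs where

open import Data.Nat using (ℕ; zero; suc; _<_; _≤_; _⊔_; _<?_)
open import Data.Fin using (Fin; toℕ; fromℕ<)
open import Data.Bool using (Bool; true; false)
open import Data.List using (List; []; _∷_; map; _++_; concatMap; zipWith; length; upTo)
open import Data.List.Membership.Propositional using (_∈_)
open import Data.Product using (Σ; _×_; _,_)
open import Data.Unit using (⊤; tt)
open import Relation.Nullary using (yes; no)
open import Relation.Binary.PropositionalEquality using (_≡_)

infixr 5 _⇒_
data Fm : Set where
  var : ℕ → Fm
  fls : Fm
  _⇒_ : Fm → Fm → Fm
  □_  : Fm → Fm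

¬' : Fm → Fm
¬' φ = φ ⇒ fls

tru : Fm
tru = ¬' fls

_∧'_ : Fm → Fm → Fm
φ ∧' ψ = ¬' (φ ⇒ ¬' ψ)

_⇔_ : Fm → Fm → Fm
φ ⇔ ψ = (φ ⇒ ψ) ∧' (ψ ⇒ φ)

◇_ : Fm → Fm
◇ φ = ¬' (□ (¬' φ))

_[_] : Fm → (ℕ → Fm) → Fm
var n [ σ ] = σ n
fls [ σ ] = fls
(φ ⇒ ψ) [ σ ] = (φ [ σ ]) ⇒ (ψ [ σ ])
(□ φ) [ σ ] = □ (φ [ σ ])

record NormalLogic (L : Fm → Set) : Set where
  field
    ax1  : ∀ φ ψ → L (φ ⇒ ψ ⇒ φ)
    ax2  : ∀ φ ψ χ → L ((φ ⇒ ψ ⇒ χ) ⇒ (φ ⇒ ψ) ⇒ (φ ⇒ χ))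
    ax3  : ∀ φ → L (¬' (¬' φ) ⇒ φ)
    axK  : ∀ φ ψ → L (□ (φ ⇒ ψ) ⇒ □ φ ⇒ □ ψ)
    mp   : ∀ {φ ψ} → L (φ ⇒ ψ) → L φ → L ψ
    nec  : ∀ {φ} → L φ → L (□ φ)
    usub : ∀ {φ} (σ : ℕ → Fm) → L φ → L (φ [ σ ])

data K : Fm → Set where
  ax1  : ∀ φ ψ → K (φ ⇒ ψ ⇒ φ)
  ax2  : ∀ φ ψ χ → K ((φ ⇒ ψ ⇒ χ) ⇒ (φ ⇒ ψ) ⇒ (φ ⇒ χ))
  ax3  : ∀ φ → K (¬' (¬' φ) ⇒ φ)
  axK  : ∀ φ ψ → K (□ (φ ⇒ ψ) ⇒ □ φ ⇒ □ ψ)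
  mp   : ∀ {φ ψ} → K (φ ⇒ ψ) → K φ → K ψ
  nec  : ∀ {φ} → K φ → K (□ φ)
  usub : ∀ {φ} (σ : ℕ → Fm) → K φ → K (φ [ σ ])

VarsBelow : ℕ → Fm → Set
VarsBelow v (var n) = n < v
VarsBelow v fls = ⊤
VarsBelow v (φ ⇒ ψ) = VarsBelow v φ × VarsBelow v ψ
VarsBelow v (□ φ) = VarsBelow v φ

md : Fm → ℕ
md (var n) = 0
md fls = 0
md (φ ⇒ ψ) = md φ ⊔ md ψ
md (□ φ) = suc (md φ)

-- φ is (a representative of) an element of K[v,d]
InKvd : ℕ → ℕ → Fm → Set
InKvd v d φ = VarsBelow v φ × md φ ≤ d

Classical : ℕ → Fm → Set
Classical v φ = VarsBelow v φ × md φ ≡ 0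

⋀ : List Fm → Fm
⋀ [] = tru
⋀ (φ ∷ φs) = φ ∧' ⋀ φs

lit : Bool → Fm → Fm
lit true φ = φ
lit false φ = ¬' φ

allSigns : ℕ → List (List Bool)
allSigns zero = [] ∷ []
allSigns (suc n) = map (true ∷_) (allSigns n) ++ map (false ∷_) (allSigns n)

level0 : ℕ → List Fm
level0 v = map (λ s → ⋀ (zipWith lit s (map var (upTo v)))) (allSigns v)

Minterms : ℕ → ℕ → List Fm
Minterms v zero = level0 v
Minterms v (suc d) =
  concatMap
    (λ m → map (λ s → m ∧' ⋀ (zipWith lit s (map ◇_ (Minterms v d))))
               (allSigns (length (Minterms v d))))
    (level0 v)

IsMinterm : ℕ → ℕ → Fm → Set
IsMinterm v d μ = μ ∈ Minterms v d

-- Characteristic minmatrix [[S]] ⊆ minterms, as a predicate: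
-- μ ∈ ⋂ { [φ] : φ ∈ K[v,d], S ⊢ φ }, where [φ] = { μ minterm : K ⊢ μ → φ }.

InCMM : (Fm → Set) → ℕ → ℕ → Fm → Set
InCMM S v d μ = IsMinterm v d μ × (∀ φ → InKvd v d φ → S φ → K (μ ⇒ φ))

Sub0 : ℕ → Set
Sub0 v = Fin v → Fm

ext : ∀ {v} → Sub0 v → ℕ → Fm
ext {v} σ n with n <? v
... | yes n<v = σ (fromℕ< n<v)
... | no _ = var n

_∘ₛ_ : Fm → ∀ {v} → Sub0 v → Fm
φ ∘ₛ σ = φ [ ext σ ]

IsSub0 : (v : ℕ) → Sub0 v → Set
IsSub0 v σ = ∀ i → Classical v (σ i)

-- invertible in the monoid of level-0 substitutions (elements of K[v,0],
-- i.e. equality up to K-equivalence; identity is (p₀,…,p_{v-1}))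
IsPrimeSub : (v : ℕ) → Sub0 v → Set
IsPrimeSub v ς =
  IsSub0 v ς ×
  Σ (Sub0 v) λ τ →
    IsSub0 v τ ×
    (∀ i → K ((ς i ∘ₛ τ) ⇔ var (toℕ i))) ×
    (∀ i → K ((τ i ∘ₛ ς) ⇔ var (toℕ i)))

InOrbit : ℕ → ℕ → Fm → Fm → Set
InOrbit v d μ₀ ν =
  IsMinterm v d ν × Σ (Sub0 v) λ ς → IsPrimeSub v ς × K (ν ⇔ (μ₀ ∘ₛ ς))

-- Let μ ≡ μ₀ ∘ ς₁ lie in [[S]],
-- ν ≡ μ₀ ∘ ς₂, and S ⊢ φ. Substituting ς₂⁻¹ and then ς₁ into φ gives a theorem of S in
-- K[v,d], which μ therefore K-entails; substituting ς₁⁻¹ and then ς₂ into that entailment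
-- turns μ into ν and the consequent back into φ, so ν K-entails φ.
module Submission where

open import Defs
open import Data.Nat using (ℕ; suc; _<_; _≤_; _<?_; _⊔_)
open import Data.Nat.Properties using (<-irrelevant)
open import Data.Fin using (toℕ; fromℕ<)
open import Data.Fin.Properties using (toℕ-fromℕ<)
open import Data.List using (List; []; _∷_)
open import Data.List.Membership.Propositional using (_∈_)
open import Data.List.Relation.Unary.Any using (here; there)
open import Data.Product using (Σ; _×_; _,_; proj₁; proj₂)
open import Data.Unit using (tt)
open import Data.Empty using (⊥-elim)
open import Relation.Nullary using (¬_; Dec; yes; no)
open import Relation.Binary.Bundles using (Setoid)
open import Relation.Binary.PropositionalEquality
  using (_≡_; refl; sym; cong; cong₂; subst)

infix 3 _⊢_

data _⊢_ (Γ : List Fm) : Fm → Set where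
  thm : ∀ {φ} → K φ → Γ ⊢ φ
  hyp : ∀ {φ} → φ ∈ Γ → Γ ⊢ φ
  app : ∀ {φ ψ} → Γ ⊢ φ ⇒ ψ → Γ ⊢ φ → Γ ⊢ ψ

⇒-refl : ∀ φ → K (φ ⇒ φ)
⇒-refl φ = mp (mp (ax2 φ (φ ⇒ φ) φ) (ax1 φ (φ ⇒ φ))) (ax1 φ φ)

deduction : ∀ {Γ φ ψ} → φ ∷ Γ ⊢ ψ → Γ ⊢ φ ⇒ ψ
deduction {φ = φ} {ψ} (thm p)           = app (thm (ax1 ψ φ)) (thm p)
deduction {φ = φ}     (hyp (here refl)) = thm (⇒-refl φ)
deduction {φ = φ} {ψ} (hyp (there p))   = app (thm (ax1 ψ φ)) (hyp p)
deduction {φ = φ} {ψ} (app {χ} p q)     =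
  app (app (thm (ax2 φ χ ψ)) (deduction p)) (deduction q)

weaken : ∀ {Γ φ ψ} → Γ ⊢ ψ → φ ∷ Γ ⊢ ψ
weaken (thm p)   = thm p
weaken (hyp p)   = hyp (there p)
weaken (app p q) = app (weaken p) (weaken q)

closed⇒K : ∀ {φ} → [] ⊢ φ → K φ
closed⇒K (thm p)   = p
closed⇒K (hyp ())
closed⇒K (app p q) = mp (closed⇒K p) (closed⇒K q)

hyp₀ : ∀ {Γ φ} → φ ∷ Γ ⊢ φ
hyp₀ = hyp (here refl)

hyp₁ : ∀ {Γ φ ψ} → φ ∷ ψ ∷ Γ ⊢ ψ
hyp₁ = hyp (there (here refl))

ex-falso : ∀ {Γ} φ → Γ ⊢ fls → Γ ⊢ φ
ex-falso φ p = app (thm (ax3 φ)) (app (thm (ax1 fls (¬' φ))) p)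

∧-intro : ∀ {Γ φ ψ} → Γ ⊢ φ → Γ ⊢ ψ → Γ ⊢ φ ∧' ψ
∧-intro p q = deduction (app (app hyp₀ (weaken p)) (weaken q))

∧-elim₁ : ∀ {Γ φ ψ} → Γ ⊢ φ ∧' ψ → Γ ⊢ φ
∧-elim₁ {φ = φ} {ψ} p =
  app (thm (ax3 φ)) (deduction (app (weaken p) (deduction (ex-falso (¬' ψ) (app hyp₁ hyp₀)))))

∧-elim₂ : ∀ {Γ φ ψ} → Γ ⊢ φ ∧' ψ → Γ ⊢ ψ
∧-elim₂ {ψ = ψ} p = app (thm (ax3 ψ)) (deduction (app (weaken p) (deduction hyp₁)))

⇒-trans : ∀ {φ ψ χ} → K (φ ⇒ ψ) → K (ψ ⇒ χ) → K (φ ⇒ χ)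
⇒-trans p q = closed⇒K (deduction (app (thm q) (app (thm p) hyp₀)))

⇒-mono : ∀ {φ φ' ψ ψ'} → K (φ' ⇒ φ) → K (ψ ⇒ ψ') → K ((φ ⇒ ψ) ⇒ (φ' ⇒ ψ'))
⇒-mono p q = closed⇒K (deduction (deduction (app (thm q) (app hyp₁ (app (thm p) hyp₀)))))

□-mono : ∀ {φ ψ} → K (φ ⇒ ψ) → K (□ φ ⇒ □ ψ)
□-mono {φ} {ψ} p = mp (axK φ ψ) (nec p)

⇔-intro : ∀ {φ ψ} → K (φ ⇒ ψ) → K (ψ ⇒ φ) → K (φ ⇔ ψ)
⇔-intro p q = closed⇒K (∧-intro (thm p) (thm q))

⇔⇒⇒ : ∀ {φ ψ} → K (φ ⇔ ψ) → K (φ ⇒ ψ)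
⇔⇒⇒ p = closed⇒K (∧-elim₁ (thm p))

⇔⇒⇐ : ∀ {φ ψ} → K (φ ⇔ ψ) → K (ψ ⇒ φ)
⇔⇒⇐ p = closed⇒K (∧-elim₂ (thm p))

⇔-refl : ∀ φ → K (φ ⇔ φ)
⇔-refl φ = ⇔-intro (⇒-refl φ) (⇒-refl φ)

⇔-sym : ∀ {φ ψ} → K (φ ⇔ ψ) → K (ψ ⇔ φ)
⇔-sym p = ⇔-intro (⇔⇒⇐ p) (⇔⇒⇒ p)

⇔-trans : ∀ {φ ψ χ} → K (φ ⇔ ψ) → K (ψ ⇔ χ) → K (φ ⇔ χ)
⇔-trans p q = ⇔-intro (⇒-trans (⇔⇒⇒ p) (⇔⇒⇒ q)) (⇒-trans (⇔⇒⇐ q) (⇔⇒⇐ p))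

⇔-setoid : Setoid _ _
⇔-setoid = record
  { Carrier       = Fm
  ; _≈_           = λ φ ψ → K (φ ⇔ ψ)
  ; isEquivalence = record { refl = ⇔-refl _ ; sym = ⇔-sym ; trans = ⇔-trans }
  }

open import Relation.Binary.Reasoning.Setoid ⇔-setoid

infixl 5 _⨾_
infix 4 _≈ₛ_

_⨾_ : (ℕ → Fm) → (ℕ → Fm) → ℕ → Fm
(σ ⨾ τ) n = σ n [ τ ]

_≈ₛ_ : (ℕ → Fm) → (ℕ → Fm) → Set
σ ≈ₛ τ = ∀ n → K (σ n ⇔ τ n)

[]-var : ∀ χ → χ [ var ] ≡ χ
[]-var (var n) = refl
[]-var fls     = refl
[]-var (χ ⇒ ψ) = cong₂ _⇒_ ([]-var χ) ([]-var ψ)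
[]-var (□ χ)   = cong □_ ([]-var χ)

[]-⨾ : ∀ χ σ τ → (χ [ σ ]) [ τ ] ≡ χ [ σ ⨾ τ ]
[]-⨾ (var n) σ τ = refl
[]-⨾ fls     σ τ = refl
[]-⨾ (χ ⇒ ψ) σ τ = cong₂ _⇒_ ([]-⨾ χ σ τ) ([]-⨾ ψ σ τ)
[]-⨾ (□ χ)   σ τ = cong □_ ([]-⨾ χ σ τ)

[]-resp-≈ₛ : ∀ χ {σ τ} → σ ≈ₛ τ → K ((χ [ σ ]) ⇔ (χ [ τ ]))
[]-resp-≈ₛ (var n) σ≈τ = σ≈τ n
[]-resp-≈ₛ fls     σ≈τ = ⇔-refl fls
[]-resp-≈ₛ (χ ⇒ ψ) σ≈τ =
  ⇔-intro (⇒-mono (⇔⇒⇐ p) (⇔⇒⇒ q)) (⇒-mono (⇔⇒⇒ p) (⇔⇒⇐ q))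
  where p = []-resp-≈ₛ χ σ≈τ
        q = []-resp-≈ₛ ψ σ≈τ
[]-resp-≈ₛ (□ χ)   σ≈τ = ⇔-intro (□-mono (⇔⇒⇒ p)) (□-mono (⇔⇒⇐ p))
  where p = []-resp-≈ₛ χ σ≈τ

[]-cancel : ∀ χ {σ τ} → σ ⨾ τ ≈ₛ var → K (((χ [ σ ]) [ τ ]) ⇔ χ)
[]-cancel χ {σ} {τ} στ≈id = begin
  (χ [ σ ]) [ τ ] ≡⟨ []-⨾ χ σ τ ⟩
  χ [ σ ⨾ τ ]     ≈⟨ []-resp-≈ₛ χ στ≈id ⟩
  χ [ var ]       ≡⟨ []-var χ ⟩
  χ               ∎

⨾-cancel-inner : ∀ {α α' β β'} → α ⨾ α' ≈ₛ var → β' ⨾ β ≈ₛ var →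
                 (β' ⨾ α) ⨾ (α' ⨾ β) ≈ₛ var
⨾-cancel-inner {α} {α'} {β} {β'} αα'≈id β'β≈id n = begin
  (β' n [ α ]) [ α' ⨾ β ]     ≡⟨ sym ([]-⨾ (β' n [ α ]) α' β) ⟩
  ((β' n [ α ]) [ α' ]) [ β ] ≈⟨ usub β ([]-cancel (β' n) αα'≈id) ⟩
  β' n [ β ]                  ≈⟨ β'β≈id n ⟩
  var n                       ∎

ext-< : ∀ {v} (σ : Sub0 v) {n} (n<v : n < v) → ext σ n ≡ σ (fromℕ< n<v)
ext-< {v} σ {n} n<v with n <? v
... | yes n<v′ = cong (λ p → σ (fromℕ< p)) (<-irrelevant n<v′ n<v)
... | no  n≮v  = ⊥-elim (n≮v n<v)

ext-≮ : ∀ {v} (σ : Sub0 v) {n} → ¬ (n < v) → ext σ n ≡ var n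
ext-≮ {v} σ {n} n≮v with n <? v
... | yes n<v = ⊥-elim (n≮v n<v)
... | no  _   = refl

ext-⨾-inverse : ∀ {v} (ς τ : Sub0 v) → (∀ i → K ((ς i ∘ₛ τ) ⇔ var (toℕ i))) →
                ext ς ⨾ ext τ ≈ₛ var
ext-⨾-inverse {v} ς τ ςτ≈id n = by-cases (n <? v)
  where
  -- a `with n <? v` would also unfold ext in the goal, out of reach of ext-< and ext-≮
  by-cases : Dec (n < v) → K ((ext ς n [ ext τ ]) ⇔ var n)
  by-cases (yes n<v) = begin
    ext ς n [ ext τ ]       ≡⟨ cong (_[ ext τ ]) (ext-< ς n<v) ⟩
    ς (fromℕ< n<v) ∘ₛ τ     ≈⟨ ςτ≈id (fromℕ< n<v) ⟩
    var (toℕ (fromℕ< n<v))  ≡⟨ cong var (toℕ-fromℕ< n<v) ⟩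
    var n                   ∎
  by-cases (no n≮v) = begin
    ext ς n [ ext τ ] ≡⟨ cong (_[ ext τ ]) (ext-≮ ς n≮v) ⟩
    ext τ n           ≡⟨ ext-≮ τ n≮v ⟩
    var n             ∎

[]-VarsBelow : ∀ {v} (σ : Sub0 v) → IsSub0 v σ →
               ∀ χ → VarsBelow v χ → VarsBelow v (χ [ ext σ ])
[]-VarsBelow {v} σ σ-cl (var n) n<v =
  subst (VarsBelow v) (sym (ext-< σ n<v)) (proj₁ (σ-cl (fromℕ< n<v)))
[]-VarsBelow σ σ-cl fls     _         = tt
[]-VarsBelow σ σ-cl (χ ⇒ ψ) (vχ , vψ) = []-VarsBelow σ σ-cl χ vχ , []-VarsBelow σ σ-cl ψ vψ
[]-VarsBelow σ σ-cl (□ χ)   vχ        = []-VarsBelow σ σ-cl χ vχ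

[]-md : ∀ {v} (σ : Sub0 v) → IsSub0 v σ →
        ∀ χ → VarsBelow v χ → md (χ [ ext σ ]) ≡ md χ
[]-md σ σ-cl (var n) n<v =
  subst (λ φ → md φ ≡ 0) (sym (ext-< σ n<v)) (proj₂ (σ-cl (fromℕ< n<v)))
[]-md σ σ-cl fls     _         = refl
[]-md σ σ-cl (χ ⇒ ψ) (vχ , vψ) = cong₂ _⊔_ ([]-md σ σ-cl χ vχ) ([]-md σ σ-cl ψ vψ)
[]-md σ σ-cl (□ χ)   vχ        = cong suc ([]-md σ σ-cl χ vχ)

[]-InKvd : ∀ {v d} (σ : Sub0 v) → IsSub0 v σ →
           ∀ χ → InKvd v d χ → InKvd v d (χ [ ext σ ])
[]-InKvd σ σ-cl χ (vχ , mdχ≤d) =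
  []-VarsBelow σ σ-cl χ vχ , subst (_≤ _) (sym ([]-md σ σ-cl χ vχ)) mdχ≤d

Entails : (Fm → Set) → ℕ → ℕ → Fm → Set
Entails S v d μ = ∀ φ → InKvd v d φ → S φ → K (μ ⇒ φ)

Entails-transfer : ∀ {S v d μ ν} → NormalLogic S → (σ ρ : ℕ → Fm) →
                   (∀ φ → InKvd v d φ → InKvd v d (φ [ σ ])) → σ ⨾ ρ ≈ₛ var →
                   K (ν ⇒ (μ [ ρ ])) → Entails S v d μ → Entails S v d ν
Entails-transfer {μ = μ} S-normal σ ρ σ-pres σρ≈id ν⇒μρ μ⊨S φ φ∈Kvd Sφ =
  ⇒-trans ν⇒μρ (⇒-trans (usub ρ μ⇒φσ) (⇔⇒⇒ ([]-cancel φ σρ≈id)))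
  where
  μ⇒φσ : K (μ ⇒ (φ [ σ ]))
  μ⇒φσ = μ⊨S (φ [ σ ]) (σ-pres φ φ∈Kvd) (NormalLogic.usub S-normal σ Sφ)

orbit-transition : ∀ {μ₀ μ ν α α' β} → K (μ ⇔ (μ₀ [ α ])) → K (ν ⇔ (μ₀ [ β ])) →
                   α ⨾ α' ≈ₛ var → K ((μ [ α' ⨾ β ]) ⇔ ν)
orbit-transition {μ₀} {μ} {ν} {α} {α'} {β} μ≈μ₀α ν≈μ₀β αα'≈id = begin
  μ [ α' ⨾ β ]                 ≡⟨ sym ([]-⨾ μ α' β) ⟩
  (μ [ α' ]) [ β ]             ≈⟨ usub β (usub α' μ≈μ₀α) ⟩
  ((μ₀ [ α ]) [ α' ]) [ β ]    ≈⟨ usub β ([]-cancel μ₀ αα'≈id) ⟩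
  μ₀ [ β ]                     ≈⟨ ⇔-sym ν≈μ₀β ⟩
  ν                            ∎

corollary6 : (v d : ℕ) (S : Fm → Set) → NormalLogic S →
    (μ₀ : Fm) → IsMinterm v d μ₀ →
    Σ Fm (λ μ → InOrbit v d μ₀ μ × InCMM S v d μ) →
    (ν : Fm) → InOrbit v d μ₀ ν → InCMM S v d ν
corollary6 v d S S-normal μ₀ _
  (μ , (_ , ς₁ , (ς₁-cl , τ₁ , _ , ς₁τ₁≈id , _) , μ≈μ₀α) , (_ , μ⊨S))
  ν (ν-minterm , ς₂ , (_ , τ₂ , τ₂-cl , _ , τ₂ς₂≈id) , ν≈μ₀β) =
  ν-minterm ,
  Entails-transfer S-normal (β' ⨾ α) (α' ⨾ β) preserves-InKvd
    (⨾-cancel-inner {α = α} {α'} {β} {β'} α⨾α'≈id β'⨾β≈id)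
    (⇔⇒⇐ (orbit-transition {μ₀} {α = α} {α'} {β} μ≈μ₀α ν≈μ₀β α⨾α'≈id))
    μ⊨S
  where
  α α' β β' : ℕ → Fm
  α  = ext ς₁
  α' = ext τ₁
  β  = ext ς₂
  β' = ext τ₂
  α⨾α'≈id : α ⨾ α' ≈ₛ var
  α⨾α'≈id = ext-⨾-inverse ς₁ τ₁ ς₁τ₁≈id
  β'⨾β≈id : β' ⨾ β ≈ₛ var
  β'⨾β≈id = ext-⨾-inverse τ₂ ς₂ τ₂ς₂≈id
  preserves-InKvd : ∀ φ → InKvd v d φ → InKvd v d (φ [ β' ⨾ α ])
  preserves-InKvd φ φ∈Kvd =
    subst (InKvd v d) ([]-⨾ φ β' α) ([]-InKvd ς₁ ς₁-cl (φ [ β' ]) ([]-InKvd τ₂ τ₂-cl φ φ∈Kvd))
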